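{- Let $\mathcal R$ be a flat object-oriented real-time rewrite theory executed under a fixed time sampling strategy, $L_\Pi$ a labeling function with $p,q\in\Pi$, $\{t_0\}$ an initial state, and $r$ a time value. Assume that (a) the set of states $\{t_i\}$ occurring on timed paths of $\mathcal R$ from $\{t_0\}$ is finite, and (b) the set of durations $r_i$ occurring on timed paths of $\mathcal R$ from $\{t_0\}$ is finite. Then the bounded response model checking algorithm for $\mathcal R$, $\{t_0\}$ and the formula $\Box\,(p\rightarrow\Diamond_{\le r}\,q)$, using the same time sampling strategy, terminates.
   Context: States of a flat object-oriented real-time rewrite theory are $\{C\}$ with $C$ a multiset of objects and messages; the only tick rule is $\{C\}\Rightarrow\{\mathrm{delta}(C,T)\}$ in time $T$ if $T\le \mathrm{mte}(C)$; instantaneous rules take zero time; under a time sampling strategy only certain tick durations are used, and the resulting executions form timed paths $t_0\xrightarrow{r_0}t_1\xrightarrow{r_1}\cdots$ (with deadlocked states repeated with duration 0). BR-transformation for $p,q,r$: add a class Clock (attributes clock: Time, status: on/off) and an object $c_{BR}$; initial state $\{t_0\ \langle c_{BR}:\mathrm{Clock}\mid \mathrm{clock}:0,\mathrm{status}:x\rangle\}$ with $x=\mathrm{on}$ iff $p$ holds and $q$ fails in $\{t_0\}$, else off; the tick rule is kept, where delta increases an on-clock with value $T$ by the elapsed time if $T\le r$ and leaves it unchanged otherwise, leaves an off-clock unchanged, and $\mathrm{mte}$ of the clock is $\infty$; each instantaneous rule $t\Rightarrow t'$ if $cond$ is replaced by four rules that perform the same rewrite on the rest of the state and update the clock: an on-clock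 stays on (value unchanged) if the new state satisfies $\neg q$ and is turned off if it satisfies $q$; an off-clock is set to $0$ and turned on if the new state satisfies $p\wedge\neg q$, and otherwise stays off with value unchanged. The bounded response model checking algorithm performs a breadth-first search of the state space of the BR-transformed theory (executed with the given time sampling strategy) from the transformed initial state, looking for a reachable state whose clock value exceeds $r$, and stops (reporting a counterexample) as soon as one such state is found, or when the reachable state space is exhausted. -}

module Defs where

open import Data.Bool using (Bool; true; false; if_then_else_; _∧_; not)
open import Data.Nat using (ℕ; zero; suc)
open import Data.Rational using (ℚ; 0ℚ; _+_; _≤_; _<_; _≤?_; _<?_; _≟_)
open import Data.List using (List; []; _∷_; _++_; map; concatMap; filter)
open import Data.List.Membership.Propositional using (_∈_)
open import Data.Product using (_×_; _,_; proj₁; proj₂; Σ; ∃)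
open import Data.Sum using (_⊎_)
open import Data.Maybe using (Maybe; just; nothing)
open import Data.Empty using (⊥)
open import Relation.Nullary using (¬_; does; yes; no)
open import Relation.Binary.Definitions using (DecidableEquality)
open import Relation.Binary.PropositionalEquality using (_≡_)
import Data.List.Membership.DecPropositional

-- Time values: nonnegative rationals (Real-Time Maude's dense time
-- domain); durations are required to be ≥ 0.  mte values may be ∞.

data Time∞ : Set where
  fin : ℚ → Time∞
  ∞   : Time∞

data _≤∞_ : ℚ → Time∞ → Set where
  ≤fin : ∀ {T U} → T ≤ U → T ≤∞ fin U
  ≤∞∞  : ∀ {T} → T ≤∞ ∞

-- A flat object-oriented real-time rewrite theory, executed under a
-- fixed time sampling strategy, abstracted as follows.
--   * Conf      : the configurations C (multisets of objects/messages);
--                 the states are {C}.  Equality of states is decidable.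
--   * inst C    : all one-step rewrites of {C} by instantaneous rules
--                 (finitely many and computable, as in Maude).
--   * delta, mte: the functions of the single tick rule
--                 {C} => {delta(C,T)} in time T if T <= mte(C).
--   * sample C  : the tick durations T the time sampling strategy
--                 tries in state {C} (finitely many); a tick step with
--                 duration T is taken iff T ∈ sample C and T ≤ mte C.

record RTTheory : Set₁ where
  field
    Conf          : Set
    _≟C_          : DecidableEquality Conf
    inst          : Conf → List Conf
    delta         : Conf → ℚ → Conf
    mte           : Conf → Time∞
    sample        : Conf → List ℚ
    sample-nonneg : ∀ C T → T ∈ sample C → 0ℚ ≤ T

module _ (R : RTTheory) where
  open RTTheory R

  data Step : Conf → ℚ → Conf → Set where
    inst-step : ∀ {C C'} → C' ∈ inst C → Step C 0ℚ C'
    tick-step : ∀ {C T} → T ∈ sample C → T ≤∞ mte C → Step C T (delta C T)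

  Deadlocked : Conf → Set
  Deadlocked C = ∀ T C' → ¬ Step C T C'

  record TimedPath (t₀ : Conf) : Set where
    field
      st    : ℕ → Conf
      dur   : ℕ → ℚ
      start : st 0 ≡ t₀
      steps : ∀ i → Step (st i) (dur i) (st (suc i))
                    ⊎ (Deadlocked (st i) × st (suc i) ≡ st i × dur i ≡ 0ℚ)
  open TimedPath public

  FiniteStatesOnPaths : Conf → Set
  FiniteStatesOnPaths t₀ =
    ∃ λ (L : List Conf) → ∀ (π : TimedPath t₀) i → st π i ∈ L

  FiniteDurationsOnPaths : Conf → Set
  FiniteDurationsOnPaths t₀ =
    ∃ λ (L : List ℚ) → ∀ (π : TimedPath t₀) i → dur π i ∈ L

data Status : Set where
  on off : Status

status-≟ : DecidableEquality Status
status-≟ on on = yes Relation.Binary.PropositionalEquality.refl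
status-≟ on off = no λ ()
status-≟ off on = no λ ()
status-≟ off off = yes Relation.Binary.PropositionalEquality.refl

record Clock : Set where
  constructor clk
  field
    value  : ℚ
    status : Status
open Clock public

clock-≟ : DecidableEquality Clock
clock-≟ (clk v s) (clk v' s') with v ≟ v' | status-≟ s s'
... | yes Relation.Binary.PropositionalEquality.refl | yes Relation.Binary.PropositionalEquality.refl = yes Relation.Binary.PropositionalEquality.refl
... | no ne | _ = no λ { Relation.Binary.PropositionalEquality.refl → ne Relation.Binary.PropositionalEquality.refl }
... | _ | no ne = no λ { Relation.Binary.PropositionalEquality.refl → ne Relation.Binary.PropositionalEquality.refl }

module BR (R : RTTheory) {Π : Set} (L : RTTheory.Conf R → Π → Bool)
          (p q : Π) (r : ℚ) where
  open RTTheory R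

  BRState : Set
  BRState = Conf × Clock

  _≟BR_ : DecidableEquality BRState
  (C , k) ≟BR (C' , k') with C ≟C C' | clock-≟ k k'
  ... | yes Relation.Binary.PropositionalEquality.refl | yes Relation.Binary.PropositionalEquality.refl = yes Relation.Binary.PropositionalEquality.refl
  ... | no ne | _ = no λ { Relation.Binary.PropositionalEquality.refl → ne Relation.Binary.PropositionalEquality.refl }
  ... | _ | no ne = no λ { Relation.Binary.PropositionalEquality.refl → ne Relation.Binary.PropositionalEquality.refl }

  pAndNotq : Conf → Bool
  pAndNotq C = L C p ∧ not (L C q)

  brInit : Conf → BRState
  brInit t₀ = t₀ , clk 0ℚ (if pAndNotq t₀ then on else off)

  -- clock update performed by the four rules replacing an
  -- instantaneous rule, given the new state C'
  updClock : Clock → Conf → Clock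
  updClock (clk v on)  C' = if L C' q then clk v off else clk v on
  updClock (clk v off) C' = if pAndNotq C' then clk 0ℚ on else clk v off

  deltaClock : Clock → ℚ → Clock
  deltaClock (clk v on)  T = if does (v ≤? r) then clk (v + T) on else clk v on
  deltaClock (clk v off) T = clk v off

  -- all one-step successors of a BR state (instantaneous rewrites
  -- followed by ticks chosen by the same sampling strategy; the mte of
  -- the clock is ∞, so the mte of the whole state is mte C)
  tickOK : Conf → ℚ → Bool
  tickOK C T with mte C
  ... | fin U = does (T ≤? U)
  ... | ∞     = true

  brSucc : BRState → List BRState
  brSucc (C , k) =
    map (λ C' → C' , updClock k C') (inst C)
    ++ map (λ T → delta C T , deltaClock k T)
           (concatMap (λ T → if tickOK C T then T ∷ [] else []) (sample C))

  fresh : List BRState → List BRState → List BRState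
  fresh seen []       = []
  fresh seen (s ∷ ss) with Data.List.Membership.DecPropositional._∈?_ _≟BR_ s seen
  ... | yes _ = fresh seen ss
  ... | no  _ = s ∷ fresh (seen ++ s ∷ []) ss

  data Result : Set where
    counterexample   : BRState → Result
    noCounterexample : Result

  -- breadth-first search with explicit fuel: 'nothing' means the fuel
  -- ran out before the algorithm stopped
  bfs : ℕ → (seen queue : List BRState) → Maybe Result
  bfs zero    seen queue    = nothing
  bfs (suc n) seen []       = just noCounterexample
  bfs (suc n) seen (s ∷ queue) with r <? value (proj₂ s)
  ... | yes _ = just (counterexample s)
  ... | no  _ = let new = fresh seen (brSucc s) in
                bfs n (seen ++ new) (queue ++ new)

  Terminates : Conf → Set
  Terminates t₀ = ∃ λ n → ∃ λ res →
    bfs n (brInit t₀ ∷ []) (brInit t₀ ∷ []) ≡ just res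

-- The breadth-first search started from the BR-transformed initial state
-- stops as soon as its queue is empty, and otherwise inserts only states
-- it has not seen before.  So it terminates once we exhibit a finite list
-- U containing every BR state it can ever visit: the measure
-- (|U| - |seen|) + |queue| then drops by one in every round.
--
-- A BR state (C , clock) is visited only if C is reachable in R and the
-- clock value is "accumulated": 0, or an accumulated value v ≤ r plus a
-- duration of a step of R.  Reachable states and their step durations lie
-- on timed paths (every finite run extends to an infinite timed path), so
-- by hypotheses (a) and (b) they range over finite lists S and D.  The
-- accumulated values are finitely many because all durations lie on the
-- grid (1 / common denominator of D) ℕ, and grid points ≤ r are bounded.

module Submission where

open import Defs
open import Data.Bool using (Bool; true; false; if_then_else_; T?)
  renaming (T to IsTrue)
open import Data.Nat
  using (ℕ; zero; suc; pred; _+_; _*_; _∸_; _≤_; _<_; z≤n; s≤s; NonZero)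
open import Data.Nat.Properties as ℕP using (module ≤-Reasoning)
open import Data.Nat.Divisibility using (_∣_; divides)
open import Data.Nat.ListAction using (product)
open import Data.Nat.ListAction.Properties using (∈⇒∣product; product≢0)
open import Data.Integer as ℤ using (+_; -[1+_])
import Data.Integer.Properties as ℤP
open import Data.Integer.Solver using (module +-*-Solver)
open import Data.Rational as ℚ using (ℚ; 0ℚ; mkℚ; toℚᵘ; fromℚᵘ; ↥_; ↧ₙ_)
open import Data.Rational.Properties
  using (fromℚᵘ-toℚᵘ; toℚᵘ-fromℚᵘ; fromℚᵘ-cong; toℚᵘ-injective;
         toℚᵘ-homo-+; toℚᵘ-mono-≤; 0/n≡0)
open import Data.Rational.Unnormalised as ℚᵘ using (mkℚᵘ; _≃_; *≡*; *≤*)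
import Data.Rational.Unnormalised.Properties as ℚᵘP
open import Data.List
  using (List; []; _∷_; _++_; map; concatMap; filterᵇ; length;
         applyUpTo; cartesianProduct; cartesianProductWith)
open import Data.List.Properties using (length-++; length-removeAt′)
open import Data.List.Membership.Propositional using (_∈_; _∉_)
open import Data.List.Membership.Propositional.Properties
  using (∈-++⁺ˡ; ∈-++⁺ʳ; ∈-++⁻; ∈-map⁺; ∈-map⁻; ∈-concat⁺′; ∈-filter⁺;
         ∈-filter⁻; ∈-applyUpTo⁺; ∈-cartesianProductWith⁺)
import Data.List.Membership.DecPropositional
open import Data.List.Relation.Unary.Any as Any using (here; there; _─_)
open import Data.List.Relation.Unary.Any.Properties using (¬Any[])
open import Data.List.Relation.Unary.All as All using (All)
import Data.List.Relation.Unary.All.Properties as AllP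
open import Data.List.Relation.Unary.AllPairs using ([]; _∷_)
open import Data.List.Relation.Unary.Unique.Propositional using (Unique)
import Data.List.Relation.Unary.Unique.Propositional.Properties as UniqueP
open import Data.List.Relation.Binary.Subset.Propositional using (_⊆_)
open import Data.Maybe using (just)
open import Function using (_∘_)
open import Data.Product using (_×_; _,_; proj₁; proj₂; Σ; ∃; ∃₂)
open import Data.Sum using (_⊎_; inj₁; inj₂)
open import Data.Empty using (⊥-elim)
open import Relation.Nullary using (Dec; does; yes; no)
open import Relation.Nullary.Decidable using (toWitness; fromWitness; isYes≗does)
open import Relation.Binary.PropositionalEquality
  using (_≡_; _≢_; refl; sym; trans; cong; cong₂; subst; module ≡-Reasoning)

module ListFacts {A : Set} where

  concatMap-guard≡filterᵇ : (b : A → Bool) (xs : List A) →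
    concatMap (λ x → if b x then x ∷ [] else []) xs ≡ filterᵇ b xs
  concatMap-guard≡filterᵇ b []       = refl
  concatMap-guard≡filterᵇ b (x ∷ xs) with b x
  ... | true  = cong (x ∷_) (concatMap-guard≡filterᵇ b xs)
  ... | false = concatMap-guard≡filterᵇ b xs

  ∈-─ : ∀ {x y} {ys : List A} (x∈ys : x ∈ ys) → y ∈ ys → x ≢ y → y ∈ (ys ─ x∈ys)
  ∈-─ (here refl)  (here refl)  x≢y = ⊥-elim (x≢y refl)
  ∈-─ (here refl)  (there y∈ys) _   = y∈ys
  ∈-─ (there x∈ys) (here refl)  _   = here refl
  ∈-─ (there x∈ys) (there y∈ys) x≢y = there (∈-─ x∈ys y∈ys x≢y)

  unique⊆⇒length≤ : ∀ {xs ys : List A} → Unique xs → xs ⊆ ys →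
                    length xs ≤ length ys
  unique⊆⇒length≤ [] _ = z≤n
  unique⊆⇒length≤ {x ∷ xs} {ys} (x≢xs ∷ unique-xs) xs⊆ys = begin
    suc (length xs)          ≤⟨ s≤s (unique⊆⇒length≤ unique-xs xs⊆ys─x) ⟩
    suc (length (ys ─ x∈ys)) ≡⟨ sym (length-removeAt′ ys (Any.index x∈ys)) ⟩
    length ys                ∎
    where
      open ≤-Reasoning
      x∈ys : x ∈ ys
      x∈ys = xs⊆ys (here refl)
      xs⊆ys─x : xs ⊆ (ys ─ x∈ys)
      xs⊆ys─x y∈xs = ∈-─ x∈ys (xs⊆ys (there y∈xs)) (All.lookup x≢xs y∈xs)

-- The grid (1 / (1 + m)) ℕ inside ℚ, with g k = k / (1 + m).
module Grid (m : ℕ) where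

  g : ℕ → ℚ
  g k = fromℚᵘ (mkℚᵘ (+ k) m)

  g-zero : g 0 ≡ 0ℚ
  g-zero = 0/n≡0 (suc m)

  g-+ : ∀ a b → g a ℚ.+ g b ≡ g (a + b)
  g-+ a b = toℚᵘ-injective (begin-equality
    toℚᵘ (g a ℚ.+ g b)                ≃⟨ toℚᵘ-homo-+ (g a) (g b) ⟩
    toℚᵘ (g a) ℚᵘ.+ toℚᵘ (g b)        ≃⟨ ℚᵘP.+-cong {toℚᵘ (g a)} {ga} {toℚᵘ (g b)} {gb}
                                           (toℚᵘ-fromℚᵘ ga) (toℚᵘ-fromℚᵘ gb) ⟩
    ga ℚᵘ.+ gb                        ≃⟨ same-denominator ⟩
    mkℚᵘ (+ (a + b)) m                ≃⟨ ℚᵘP.≃-sym (toℚᵘ-fromℚᵘ _) ⟩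
    toℚᵘ (g (a + b))                  ∎)
    where
      open ℚᵘP.≤-Reasoning
      open +-*-Solver
      ga = mkℚᵘ (+ a) m
      gb = mkℚᵘ (+ b) m
      n = + suc m
      same-denominator : ga ℚᵘ.+ gb ≃ mkℚᵘ (+ (a + b)) m
      same-denominator = *≡* (trans
        (solve 3 (λ x y z → (x :* z :+ y :* z) :* z := (x :+ y) :* (z :* z))
               refl (+ a) (+ b) n)
        (sym (cong₂ ℤ._*_
               (ℤP.pos-+ a b) (ℤP.pos-* (suc m) (suc m)))))

  on-grid : ∀ T → 0ℚ ℚ.≤ T → ↧ₙ T ∣ suc m → ∃ λ t → T ≡ g t
  on-grid T@(mkℚ (+ n) d _) _ (divides c 1+m≡c*d) = n * c , (begin
    T                        ≡⟨ sym (fromℚᵘ-toℚᵘ T) ⟩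
    fromℚᵘ (mkℚᵘ (+ n) d)    ≡⟨ fromℚᵘ-cong {mkℚᵘ (+ n) d} {mkℚᵘ (+ (n * c)) m} (*≡* cross) ⟩
    g (n * c)                ∎)
    where
      open ≡-Reasoning
      cross : + n ℤ.* + suc m ≡ + (n * c) ℤ.* + suc d
      cross = begin
        + n ℤ.* + suc m          ≡⟨ sym (ℤP.pos-* n (suc m)) ⟩
        + (n * suc m)            ≡⟨ cong (λ k → + (n * k)) 1+m≡c*d ⟩
        + (n * (c * suc d))      ≡⟨ cong +_ (sym (ℕP.*-assoc n c (suc d))) ⟩
        + (n * c * suc d)        ≡⟨ ℤP.pos-* (n * c) (suc d) ⟩
        + (n * c) ℤ.* + suc d    ∎
  on-grid (mkℚ -[1+ _ ] _ _) (ℚ.*≤* ()) _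

  g-bounded : ∀ r → ∃ λ K → ∀ k → g k ℚ.≤ r → k ≤ K
  g-bounded r = ℤ.∣ ↥ r ∣ * suc m , λ k gk≤r → bound r k (cross-≤ r k gk≤r)
    where
      cross-≤ : ∀ r k → g k ℚ.≤ r →
                + (k * ↧ₙ r) ℤ.≤ ↥ r ℤ.* + suc m
      cross-≤ r@(mkℚ _ _ _) k gk≤r
        with ℚᵘP.≤-respˡ-≃ (toℚᵘ-fromℚᵘ (mkℚᵘ (+ k) m)) (toℚᵘ-mono-≤ gk≤r)
      ... | *≤* k*d≤r*n = subst (ℤ._≤ _) (sym (ℤP.pos-* k (↧ₙ r))) k*d≤r*n
      bound : ∀ r k → + (k * ↧ₙ r) ℤ.≤ ↥ r ℤ.* + suc m → k ≤ ℤ.∣ ↥ r ∣ * suc m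
      bound (mkℚ (+ a) d _) k k*d≤a*n = ℕP.≤-trans (ℕP.m≤m*n k (suc d))
        (ℤP.drop‿+≤+ (subst (_ ℤ.≤_) (sym (ℤP.pos-* a (suc m))) k*d≤a*n))
      bound (mkℚ -[1+ _ ] _ _) k ()

-- Accumulated clock values, i.e. the values an on-clock can take: it
-- starts at 0 and, while its value is ≤ r, is advanced by nonnegative
-- durations from a list D.
module Accumulation (D : List ℚ) (r : ℚ) where

  data Accumulated : ℚ → Set where
    origin  : Accumulated 0ℚ
    advance : ∀ {v T} → Accumulated v → v ℚ.≤ r → T ∈ D → 0ℚ ℚ.≤ T →
              Accumulated (v ℚ.+ T)

  -- The product of the denominators of D is a positive common denominator.
  instance
    denominators-nonZero : NonZero (product (map ↧ₙ_ D))
    denominators-nonZero =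
      product≢0 (AllP.map⁺ (All.tabulate {xs = D} (λ _ → _)))

  open Grid (pred (product (map ↧ₙ_ D)))

  duration-on-grid : ∀ {T} → T ∈ D → 0ℚ ℚ.≤ T → ∃ λ t → T ≡ g t
  duration-on-grid {T} T∈D 0≤T = on-grid T 0≤T
    (subst (↧ₙ T ∣_) (sym (ℕP.suc-pred (product (map ↧ₙ_ D))))
           (∈⇒∣product (∈-map⁺ ↧ₙ_ T∈D)))

  accumulated-on-grid : ∀ {v} → Accumulated v → ∃ λ k → v ≡ g k
  accumulated-on-grid origin = 0 , sym g-zero
  accumulated-on-grid (advance acc _ T∈D 0≤T)
    with accumulated-on-grid acc | duration-on-grid T∈D 0≤T
  ... | k , refl | t , refl = k + t , g-+ k t

  lowGrid : List ℚ
  lowGrid = applyUpTo g (suc (proj₁ (g-bounded r)))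

  lowGrid-complete : ∀ {v} k → v ≡ g k → v ℚ.≤ r → v ∈ lowGrid
  lowGrid-complete k refl gk≤r = ∈-applyUpTo⁺ g (s≤s (proj₂ (g-bounded r) k gk≤r))

  clockValues : List ℚ
  clockValues = lowGrid ++ concatMap (λ v → map (v ℚ.+_) D) lowGrid

  accumulated-finite : ∀ {v} → Accumulated v → v ∈ clockValues
  accumulated-finite origin =
    ∈-++⁺ˡ (subst (_∈ lowGrid) g-zero (∈-applyUpTo⁺ g (s≤s z≤n)))
  accumulated-finite (advance {v} acc v≤r T∈D _) =
    ∈-++⁺ʳ lowGrid (∈-concat⁺′ (∈-map⁺ (v ℚ.+_) T∈D)
                               (∈-map⁺ (λ v → map (v ℚ.+_) D) v∈lowGrid))
    where
      v∈lowGrid : v ∈ lowGrid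
      v∈lowGrid = let k , v≡gk = accumulated-on-grid acc in lowGrid-complete k v≡gk v≤r

module TimedPaths (R : RTTheory) where
  open RTTheory R

  PathStep : Conf → ℚ → Conf → Set
  PathStep C T C' = Step R C T C' ⊎ (Deadlocked R C × C' ≡ C × T ≡ 0ℚ)

  Progress : Conf → Set
  Progress C = (∃₂ λ T C' → Step R C T C') ⊎ Deadlocked R C

  pathStep : ∀ {C} → Progress C → ∃₂ λ T C' → PathStep C T C'
  pathStep (inj₁ (T , C' , step))  = T , C' , inj₁ step
  pathStep {C} (inj₂ deadlocked)   = 0ℚ , C , inj₂ (deadlocked , refl , refl)

  pathFrom : (∀ C → Progress C) → ∀ C → TimedPath R C
  pathFrom progress C = record
    { st    = states
    ; dur   = λ i → proj₁ (choice (states i))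
    ; start = refl
    ; steps = λ i → proj₂ (proj₂ (choice (states i)))
    }
    where
      choice : ∀ C → ∃₂ λ T C' → PathStep C T C'
      choice C = pathStep (progress C)
      states : ℕ → Conf
      states zero    = C
      states (suc i) = proj₁ (proj₂ (choice (states i)))

  _◅_ : ∀ {C T C'} → Step R C T C' → TimedPath R C' → TimedPath R C
  _◅_ {C} {T} step π = record
    { st    = λ { zero → C ; (suc i) → st π i }
    ; dur   = λ { zero → T ; (suc i) → dur π i }
    ; start = refl
    ; steps = λ { zero    → inj₁ (subst (Step R C T) (sym (start π)) step)
                ; (suc i) → steps π i }
    }

  data Reach (t₀ : Conf) : Conf → Set where
    initial : Reach t₀ t₀
    after   : ∀ {C T C'} → Reach t₀ C → Step R C T C' → Reach t₀ C'

  Suffix : ∀ {C C'} → TimedPath R C → TimedPath R C' → Set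
  Suffix ρ π = ∃ λ k → ∀ j → st ρ (k + j) ≡ st π j × dur ρ (k + j) ≡ dur π j

  embed : ∀ {t₀ C} → Reach t₀ C → (π : TimedPath R C) →
          Σ (TimedPath R t₀) λ ρ → Suffix ρ π
  embed initial π = π , 0 , λ j → refl , refl
  embed (after reach step) π with embed reach (step ◅ π)
  ... | ρ , k , agree = ρ , suc k , λ j →
        subst (λ i → st ρ i ≡ st π j × dur ρ i ≡ dur π j)
              (ℕP.+-suc k j) (agree (suc j))

  module _ (progress : ∀ C → Progress C) where

    reachable-on-path : ∀ {t₀ C} → Reach t₀ C →
                        ∃ λ (ρ : TimedPath R t₀) → ∃ λ i → st ρ i ≡ C
    reachable-on-path reach =
      let ρ , k , agree = embed reach (pathFrom progress _)
      in ρ , k + 0 , proj₁ (agree 0)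

    step-on-path : ∀ {t₀ C T C'} → Reach t₀ C → Step R C T C' →
                   ∃ λ (ρ : TimedPath R t₀) → ∃ λ i → dur ρ i ≡ T
    step-on-path reach step =
      let ρ , k , agree = embed reach (step ◅ pathFrom progress _)
      in ρ , k + 0 , proj₂ (agree 0)

-- Moving c states from the unseen part into the queue preserves
-- (unseen + queue length); this is the bookkeeping of one search round.
transfer-unseen : ∀ a b c d → b + c ≤ a → (a ∸ (b + c)) + (d + c) ≡ (a ∸ b) + d
transfer-unseen a b c d b+c≤a = begin
  (a ∸ (b + c)) + (d + c)     ≡⟨ cong₂ _+_ (sym (ℕP.∸-+-assoc a b c)) (ℕP.+-comm d c) ⟩
  ((a ∸ b) ∸ c) + (c + d)     ≡⟨ sym (ℕP.+-assoc ((a ∸ b) ∸ c) c d) ⟩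
  (((a ∸ b) ∸ c) + c) + d     ≡⟨ cong (_+ d) (ℕP.m∸n+n≡m c≤a∸b) ⟩
  (a ∸ b) + d                 ∎
  where
    open ≡-Reasoning
    c≤a∸b : c ≤ a ∸ b
    c≤a∸b = ℕP.m+n≤o⇒m≤o∸n c (subst (_≤ a) (ℕP.+-comm b c) b+c≤a)

module BRSearch (R : RTTheory) {Π : Set} (L : RTTheory.Conf R → Π → Bool)
                (p q : Π) (r : ℚ) where
  open RTTheory R
  open BR R L p q r
  open TimedPaths R using (Progress)
  open Data.List.Membership.DecPropositional _≟BR_ using (_∈?_)

  ticks : Conf → List ℚ
  ticks C = concatMap (λ T → if tickOK C T then T ∷ [] else []) (sample C)

  tickOK-sound : ∀ C T → IsTrue (tickOK C T) → T ≤∞ mte C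
  tickOK-sound C T ok with mte C
  ... | ∞     = ≤∞∞
  ... | fin U = ≤fin (toWitness (subst IsTrue (sym (isYes≗does (T ℚ.≤? U))) ok))

  tickOK-complete : ∀ C T → T ≤∞ mte C → IsTrue (tickOK C T)
  tickOK-complete C T T≤mte with mte C | T≤mte
  ... | ∞     | ≤∞∞      = _
  ... | fin U | ≤fin T≤U = subst IsTrue (isYes≗does (T ℚ.≤? U)) (fromWitness T≤U)

  ∈-ticks⁻ : ∀ {C T} → T ∈ ticks C → T ∈ sample C × T ≤∞ mte C
  ∈-ticks⁻ {C} {T} T∈ticks
    with ∈-filter⁻ (T? ∘ tickOK C)
           (subst (T ∈_) (ListFacts.concatMap-guard≡filterᵇ (tickOK C) (sample C)) T∈ticks)
  ... | T∈sample , ok = T∈sample , tickOK-sound C T ok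

  ∈-ticks⁺ : ∀ {C T} → T ∈ sample C → T ≤∞ mte C → T ∈ ticks C
  ∈-ticks⁺ {C} {T} T∈sample T≤mte =
    subst (T ∈_) (sym (ListFacts.concatMap-guard≡filterᵇ (tickOK C) (sample C)))
          (∈-filter⁺ (T? ∘ tickOK C) T∈sample (tickOK-complete C T T≤mte))

  data BRStep : BRState → ℚ → BRState → Set where
    inst-move : ∀ {C C' k} → C' ∈ inst C →
                BRStep (C , k) 0ℚ (C' , updClock k C')
    tick-move : ∀ {C T k} → T ∈ sample C → T ≤∞ mte C →
                BRStep (C , k) T (delta C T , deltaClock k T)

  underlying : ∀ {s T s'} → BRStep s T s' → Step R (proj₁ s) T (proj₁ s')
  underlying (inst-move C'∈inst)         = inst-step C'∈inst
  underlying (tick-move T∈sample T≤mte)  = tick-step T∈sample T≤mte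

  brSucc-sound : ∀ {C k s'} → s' ∈ brSucc (C , k) → ∃ λ T → BRStep (C , k) T s'
  brSucc-sound {C} {k} s'∈succ
    with ∈-++⁻ (map (λ C' → C' , updClock k C') (inst C)) s'∈succ
  ... | inj₁ s'∈insts with ∈-map⁻ (λ C' → C' , updClock k C') s'∈insts
  ...   | C' , C'∈inst , refl = 0ℚ , inst-move C'∈inst
  brSucc-sound {C} {k} s'∈succ | inj₂ s'∈ticks
    with ∈-map⁻ (λ T → delta C T , deltaClock k T) s'∈ticks
  ...   | T , T∈ticks , refl =
          let T∈sample , T≤mte = ∈-ticks⁻ T∈ticks in T , tick-move T∈sample T≤mte

  step-simulated : ∀ {C T C'} → Step R C T C' → ∀ k →
                   ∃ λ k' → (C' , k') ∈ brSucc (C , k)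
  step-simulated {C} (inst-step C'∈inst) k =
    updClock k _ , ∈-++⁺ˡ (∈-map⁺ (λ C' → C' , updClock k C') C'∈inst)
  step-simulated {C} (tick-step T∈sample T≤mte) k =
    deltaClock k _ , ∈-++⁺ʳ (map (λ C' → C' , updClock k C') (inst C))
      (∈-map⁺ (λ T → delta C T , deltaClock k T) (∈-ticks⁺ T∈sample T≤mte))

  -- Hence progress of R is decidable: inspect the successors of C under
  -- an arbitrary clock.
  idle : Clock
  idle = clk 0ℚ off

  progress : ∀ C → Progress C
  progress C with brSucc (C , idle) in succ≡
  ... | [] = inj₂ λ T C' step →
          let k' , C'∈succ = step-simulated step idle
          in ¬Any[] (subst ((C' , k') ∈_) succ≡ C'∈succ)
  ... | s' ∷ _ =
          let T , move = brSucc-sound {C} {idle} (subst (s' ∈_) (sym succ≡) (here refl))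
          in inj₁ (T , proj₁ s' , underlying move)

  fresh-new : ∀ seen xs {z} → z ∈ fresh seen xs → z ∉ seen
  fresh-new seen (s ∷ ss) z∈fresh with s ∈? seen
  fresh-new seen (s ∷ ss) z∈fresh          | yes _ = fresh-new seen ss z∈fresh
  fresh-new seen (s ∷ ss) (here refl)      | no s∉seen = s∉seen
  fresh-new seen (s ∷ ss) (there z∈fresh)  | no _ =
    fresh-new (seen ++ s ∷ []) ss z∈fresh ∘ ∈-++⁺ˡ

  fresh-unique : ∀ seen xs → Unique (fresh seen xs)
  fresh-unique seen [] = []
  fresh-unique seen (s ∷ ss) with s ∈? seen
  ... | yes _ = fresh-unique seen ss
  ... | no  _ = All.tabulate s≢ ∷ fresh-unique (seen ++ s ∷ []) ss
    where
      s≢ : ∀ {z} → z ∈ fresh (seen ++ s ∷ []) ss → s ≢ z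
      s≢ z∈fresh refl = fresh-new (seen ++ s ∷ []) ss z∈fresh (∈-++⁺ʳ seen (here refl))

  fresh⊆ : ∀ seen xs → fresh seen xs ⊆ xs
  fresh⊆ seen (s ∷ ss) z∈fresh with s ∈? seen
  fresh⊆ seen (s ∷ ss) z∈fresh          | yes _ = there (fresh⊆ seen ss z∈fresh)
  fresh⊆ seen (s ∷ ss) (here refl)      | no _  = here refl
  fresh⊆ seen (s ∷ ss) (there z∈fresh)  | no _  =
    there (fresh⊆ (seen ++ s ∷ []) ss z∈fresh)

  module Termination (Good : BRState → Set)
                     (good-closed : ∀ {s s'} → Good s → s' ∈ brSucc s → Good s')
                     (U : List BRState) (good⊆U : ∀ {s} → Good s → s ∈ U) where

    record Invariant (seen queue : List BRState) : Set where
      field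
        seen-unique : Unique seen
        seen-good   : All Good seen
        queue-good  : All Good queue

    measure : List BRState → List BRState → ℕ
    measure seen queue = (length U ∸ length seen) + length queue

    module Round {seen s queue} (inv : Invariant seen (s ∷ queue)) where
      open Invariant inv

      new : List BRState
      new = fresh seen (brSucc s)

      new-good : All Good new
      new-good = All.tabulate λ z∈new →
        good-closed (All.head queue-good) (fresh⊆ seen (brSucc s) z∈new)

      invariant : Invariant (seen ++ new) (queue ++ new)
      invariant = record
        { seen-unique = UniqueP.++⁺ seen-unique (fresh-unique seen (brSucc s))
                          λ (z∈seen , z∈new) → fresh-new seen (brSucc s) z∈new z∈seen
        ; seen-good   = AllP.++⁺ seen-good new-good
        ; queue-good  = AllP.++⁺ (All.tail queue-good) new-good
        }

      -- all seen states are distinct elements of U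
      seen-fits : length seen + length new ≤ length U
      seen-fits = subst (_≤ length U) (length-++ seen)
        (ListFacts.unique⊆⇒length≤ (Invariant.seen-unique invariant)
          (good⊆U ∘ All.lookup (Invariant.seen-good invariant)))

      decreases : measure (seen ++ new) (queue ++ new) < measure seen (s ∷ queue)
      decreases = begin-strict
        (length U ∸ length (seen ++ new)) + length (queue ++ new)
          ≡⟨ cong₂ (λ b d → (length U ∸ b) + d) (length-++ seen) (length-++ queue) ⟩
        (length U ∸ (length seen + length new)) + (length queue + length new)
          ≡⟨ transfer-unseen (length U) (length seen) (length new) (length queue)
                             seen-fits ⟩
        (length U ∸ length seen) + length queue
          <⟨ ℕP.+-monoʳ-< (length U ∸ length seen) (ℕP.n<1+n (length queue)) ⟩
        (length U ∸ length seen) + suc (length queue)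
          ∎
        where open ≤-Reasoning

    bfs-halts : ∀ n seen queue → Invariant seen queue → measure seen queue < n →
                ∃ λ res → bfs n seen queue ≡ just res
    bfs-halts (suc n) seen []          _   _ = noCounterexample , refl
    bfs-halts (suc n) seen (s ∷ queue) inv μ<1+n with r ℚ.<? value (proj₂ s)
    ... | yes _ = counterexample s , refl
    ... | no  _ = bfs-halts n (seen ++ new) (queue ++ new) invariant
                    (ℕP.<-≤-trans decreases (ℕP.≤-pred μ<1+n))
      where open Round inv

    terminates : ∀ t₀ → Good (brInit t₀) → Terminates t₀
    terminates t₀ good = suc (measure init init) , bfs-halts _ init init invariant (ℕP.n<1+n _)
      where
        init : List BRState
        init = brInit t₀ ∷ []
        invariant : Invariant init init
        invariant = record
          { seen-unique = All.[] ∷ []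
          ; seen-good   = good All.∷ All.[]
          ; queue-good  = good All.∷ All.[]
          }

module ReachableBRStates (R : RTTheory) {Π : Set} (L : RTTheory.Conf R → Π → Bool)
                         (p q : Π) (r : ℚ) (t₀ : RTTheory.Conf R)
                         (finite-states : FiniteStatesOnPaths R t₀)
                         (finite-durations : FiniteDurationsOnPaths R t₀) where
  open RTTheory R
  open BR R L p q r
  open TimedPaths R
  open BRSearch R L p q r
  open Accumulation (proj₁ finite-durations) r

  S : List Conf
  S = proj₁ finite-states

  D : List ℚ
  D = proj₁ finite-durations

  Good : BRState → Set
  Good (C , k) = Reach t₀ C × Accumulated (value k)

  good-init : Good (brInit t₀)
  good-init = initial , origin

  updClock-accumulated : ∀ k C' → Accumulated (value k) →
                         Accumulated (value (updClock k C'))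
  updClock-accumulated (clk v on) C' acc with L C' q
  ... | true  = acc
  ... | false = acc
  updClock-accumulated (clk v off) C' acc with pAndNotq C'
  ... | true  = origin
  ... | false = acc

  deltaClock-accumulated : ∀ k {T} → T ∈ D → 0ℚ ℚ.≤ T → Accumulated (value k) →
                           Accumulated (value (deltaClock k T))
  deltaClock-accumulated (clk v off) _ _ acc = acc
  deltaClock-accumulated (clk v on) {T} T∈D 0≤T acc = advance-if (v ℚ.≤? r)
    where
      advance-if : (v≤?r : Dec (v ℚ.≤ r)) →
        Accumulated (value (if does v≤?r then clk (v ℚ.+ T) on else clk v on))
      advance-if (yes v≤r) = advance acc v≤r T∈D 0≤T
      advance-if (no  _)   = acc

  duration∈D : ∀ {C T C'} → Reach t₀ C → Step R C T C' → T ∈ D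
  duration∈D reach step =
    let ρ , i , dur≡T = step-on-path progress reach step
    in subst (_∈ D) dur≡T (proj₂ finite-durations ρ i)

  state∈S : ∀ {C} → Reach t₀ C → C ∈ S
  state∈S reach =
    let ρ , i , st≡C = reachable-on-path progress reach
    in subst (_∈ S) st≡C (proj₂ finite-states ρ i)

  good-closed : ∀ {s s'} → Good s → s' ∈ brSucc s → Good s'
  good-closed {C , k} (reach , acc) s'∈succ with brSucc-sound {C} {k} s'∈succ
  ... | _ , inst-move C'∈inst =
        after reach (inst-step C'∈inst) , updClock-accumulated k _ acc
  ... | T , tick-move T∈sample T≤mte =
        after reach step ,
        deltaClock-accumulated k (duration∈D reach step) (sample-nonneg C T T∈sample) acc
    where
      step : Step R C T (delta C T)
      step = tick-step T∈sample T≤mte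

  U : List BRState
  U = cartesianProduct S (cartesianProductWith clk clockValues (on ∷ off ∷ []))

  good⊆U : ∀ {s} → Good s → s ∈ U
  good⊆U {C , clk v σ} (reach , acc) =
    ∈-cartesianProductWith⁺ _,_ (state∈S reach)
      (∈-cartesianProductWith⁺ clk (accumulated-finite acc) (status∈ σ))
    where
      status∈ : ∀ σ → σ ∈ on ∷ off ∷ []
      status∈ on  = here refl
      status∈ off = there (here refl)

  open Termination Good (λ {s} {s'} → good-closed {s} {s'}) U (λ {s} → good⊆U {s})
    public

lemma3 : (R : RTTheory) {Π : Set} (L : RTTheory.Conf R → Π → Bool)
         (p q : Π) (t₀ : RTTheory.Conf R) (r : ℚ) →
         FiniteStatesOnPaths R t₀ →
         FiniteDurationsOnPaths R t₀ →
         BR.Terminates R L p q r t₀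
lemma3 R L p q t₀ r finite-states finite-durations = terminates t₀ good-init
  where open ReachableBRStates R L p q r t₀ finite-states finite-durations
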